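{- Let $(S_\bot,M)$ be a $C$-monoid where $M$ is an ada, $\theta$ a maximal congruence on $M$, $E_\theta=\{(s,t)\in S_\bot\times S_\bot: \beta[s,t]=\beta[t,t]\text{ for some }\beta\in M\text{ with }(\beta,T)\in\theta\}$ (an equivalence relation on $S_\bot$), and $S_\theta=(S_\bot/E_\theta)\setminus\{\overline{\bot}\}$. For $\alpha\in M$ put $A^\alpha_\theta=\{\overline{t}: (t\circ\alpha,T)\in\theta\}$ and $B^\alpha_\theta=\{\overline{t}:(t\circ\alpha,F)\in\theta\}$. Define $\rho_\theta:M\to\mathbb{3}^{S_\theta}$ by: $\rho_\theta(T)$ is the constant map $T$, $\rho_\theta(F)$ is the constant map $F$, and for $\alpha\notin\{T,F\}$, $\rho_\theta(\alpha)$ is the map taking value $T$ on $A^\alpha_\theta$, $F$ on $B^\alpha_\theta$ and $U$ elsewhere. Then $\rho_\theta$ is well defined (i.e., $A^\alpha_\theta$ and $B^\alpha_\theta$ are disjoint subsets of $S_\theta$, independent of representatives) and is a homomorphism of $C$-algebras with $T,F,U$.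
   Context: A $C$-algebra is an algebra $(M,\vee,\wedge,\neg)$ of type $(2,2,1)$ satisfying, for all $\alpha,\beta,\gamma$: $\neg\neg\alpha=\alpha$; $\neg(\alpha\wedge\beta)=\neg\alpha\vee\neg\beta$; $(\alpha\wedge\beta)\wedge\gamma=\alpha\wedge(\beta\wedge\gamma)$; $\alpha\wedge(\beta\vee\gamma)=(\alpha\wedge\beta)\vee(\alpha\wedge\gamma)$; $(\alpha\vee\beta)\wedge\gamma=(\alpha\wedge\gamma)\vee(\neg\alpha\wedge\beta\wedge\gamma)$; $\alpha\vee(\alpha\wedge\beta)=\alpha$; $(\alpha\wedge\beta)\vee(\beta\wedge\alpha)=(\beta\wedge\alpha)\vee(\alpha\wedge\beta)$. A $C$-algebra with $T,F,U$ has constants $T$ (two-sided identity for $\wedge$), $F$ (two-sided identity for $\vee$), $U$ (fixed point of $\neg$). An ada is a $C$-algebra with $T,F,U$ and a unary operation $(\ )^\downarrow$ with $F^\downarrow=F$, $U^\downarrow=F$, $T^\downarrow=T$, $\alpha\wedge\beta^\downarrow=\alpha\wedge(\alpha\wedge\beta)^\downarrow$, $\alpha^\downarrow\vee\neg(\alpha^\downarrow)=T$, $\alpha=\alpha^\downarrow\vee\alpha$. $\mathbb{3}=\{T,F,U\}$ with $\neg T=F,\neg F=T,\neg U=U$; $T\wedge x=x$, $F\wedge x=F$, $U\wedge x=U$; $T\vee x=T$, $F\vee x=x$, $U\vee x=U$; for a set $Y$, $\mathbb{3}^Y$ has pointwise operations and constants. Write $\alpha\llbracket\beta,\gamma\rrbracket=(\alpha\wedge\beta)\vee(\neg\alpha\wedge\gamma)$.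 A maximal congruence is a congruence on $M$ maximal among those different from $M\times M$. A $C$-set is a pair $(S_\bot,M)$, $S_\bot$ a pointed set with base point $\bot$, $M$ a $C$-algebra with $T,F,U$, with a map $(\alpha,s,t)\mapsto\alpha[s,t]$, $M\times S_\bot\times S_\bot\to S_\bot$, such that: $U[s,t]=\bot$; $F[s,t]=t$; $(\neg\alpha)[s,t]=\alpha[t,s]$; $\alpha[\alpha[s,t],u]=\alpha[s,u]$; $\alpha[s,\alpha[t,u]]=\alpha[s,u]$; $(\alpha\wedge\beta)[s,t]=\alpha[\beta[s,t],t]$; $\alpha[\beta[s,t],\beta[u,v]]=\beta[\alpha[s,u],\alpha[t,v]]$; and $\alpha[s,t]=\alpha[t,t]\Rightarrow(\alpha\wedge\beta)[s,t]=(\alpha\wedge\beta)[t,t]$. A $C$-monoid is a $C$-set $(S_\bot,M)$ where $(S_\bot,\cdot)$ is a monoid with identity $1$ and zero $\bot$ (the base point), with a map $\circ:S_\bot\times M\to M$ such that for all $s,t,r,u\in S_\bot,\alpha,\beta\in M$: $\bot\circ\alpha=U$; $t\circ U=U$; $1\circ\alpha=\alpha$; $s\circ(\neg\alpha)=\neg(s\circ\alpha)$; $s\circ(\alpha\wedge\beta)=(s\circ\alpha)\wedge(s\circ\beta)$; $(s\cdot t)\circ\alpha=s\circ(t\circ\alpha)$; $\alpha[s,t]\cdot u=\alpha[s\cdot u,t\cdot u]$; $r\cdot\alpha[s,t]=(r\circ\alpha)[r\cdot s,r\cdot t]$; $\alpha[s,t]\circ\beta=\alpha\llbracket s\circ\beta,t\circ\beta\rrbracket$.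 -}

module Defs where

open import Level using (Level; _⊔_) renaming (suc to lsuc)
open import Relation.Binary.PropositionalEquality using (_≡_)
open import Relation.Nullary using (¬_; Dec; yes; no)
open import Relation.Binary using (Rel; IsEquivalence)
open import Data.Product using (Σ; _×_)
open import Axiom.ExcludedMiddle using (ExcludedMiddle)

infixr 7 _∧₃_
infixr 6 _∨₃_
infix  8 ~₃_

record CAlgebra (ℓ : Level) : Set (lsuc ℓ) where
  field
    Carrier : Set ℓ
    _∨_ : Carrier → Carrier → Carrier
    _∧_ : Carrier → Carrier → Carrier
    ~_  : Carrier → Carrier
  infixr 7 _∧_
  infixr 6 _∨_
  infix 8 ~_
  field
    ~~       : ∀ a → ~ (~ a) ≡ a
    deMorgan : ∀ a b → ~ (a ∧ b) ≡ (~ a) ∨ (~ b)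
    ∧-assoc  : ∀ a b c → (a ∧ b) ∧ c ≡ a ∧ (b ∧ c)
    ∧-distribˡ : ∀ a b c → a ∧ (b ∨ c) ≡ (a ∧ b) ∨ (a ∧ c)
    ∨∧-distribʳ : ∀ a b c → (a ∨ b) ∧ c ≡ (a ∧ c) ∨ ((~ a) ∧ b ∧ c)
    absorb   : ∀ a b → a ∨ (a ∧ b) ≡ a
    ∨∧-comm  : ∀ a b → (a ∧ b) ∨ (b ∧ a) ≡ (b ∧ a) ∨ (a ∧ b)

record CAlgebraTFU (ℓ : Level) : Set (lsuc ℓ) where
  field
    calg : CAlgebra ℓ
  open CAlgebra calg public
  field
    T F U : Carrier
    ∧-identityˡ : ∀ a → T ∧ a ≡ a
    ∧-identityʳ : ∀ a → a ∧ T ≡ a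
    ∨-identityˡ : ∀ a → F ∨ a ≡ a
    ∨-identityʳ : ∀ a → a ∨ F ≡ a
    ~U : ~ U ≡ U

  _⟦_,_⟧ : Carrier → Carrier → Carrier → Carrier
  a ⟦ b , c ⟧ = (a ∧ b) ∨ ((~ a) ∧ c)

record Ada (ℓ : Level) : Set (lsuc ℓ) where
  field
    tfu : CAlgebraTFU ℓ
  open CAlgebraTFU tfu public
  field
    _↓ : Carrier → Carrier
    F↓ : F ↓ ≡ F
    U↓ : U ↓ ≡ F
    T↓ : T ↓ ≡ T
    ∧↓ : ∀ a b → a ∧ (b ↓) ≡ a ∧ ((a ∧ b) ↓)
    ↓∨~↓ : ∀ a → (a ↓) ∨ (~ (a ↓)) ≡ T
    ↓∨ : ∀ a → a ≡ (a ↓) ∨ a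

record CMonoid {ℓ : Level} (M : CAlgebraTFU ℓ) : Set (lsuc ℓ) where
  open CAlgebraTFU M
  field
    S : Set ℓ
    ⊥ : S
    _[_,_] : Carrier → S → S → S
    U[] : ∀ s t → U [ s , t ] ≡ ⊥
    F[] : ∀ s t → F [ s , t ] ≡ t
    ~[] : ∀ α s t → (~ α) [ s , t ] ≡ α [ t , s ]
    [[]]ˡ : ∀ α s t u → α [ α [ s , t ] , u ] ≡ α [ s , u ]
    [[]]ʳ : ∀ α s t u → α [ s , α [ t , u ] ] ≡ α [ s , u ]
    ∧[] : ∀ α β s t → (α ∧ β) [ s , t ] ≡ α [ β [ s , t ] , t ]
    [][] : ∀ α β s t u v →
      α [ β [ s , t ] , β [ u , v ] ] ≡ β [ α [ s , u ] , α [ t , v ] ]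
    []-cong : ∀ α β s t → α [ s , t ] ≡ α [ t , t ] →
      (α ∧ β) [ s , t ] ≡ (α ∧ β) [ t , t ]
    _·_ : S → S → S
    𝟙 : S
    ·-assoc : ∀ s t u → (s · t) · u ≡ s · (t · u)
    ·-identityˡ : ∀ s → 𝟙 · s ≡ s
    ·-identityʳ : ∀ s → s · 𝟙 ≡ s
    ·-zeroˡ : ∀ s → ⊥ · s ≡ ⊥
    ·-zeroʳ : ∀ s → s · ⊥ ≡ ⊥
    _∘_ : S → Carrier → Carrier
    ⊥∘ : ∀ α → ⊥ ∘ α ≡ U
    ∘U : ∀ t → t ∘ U ≡ U
    𝟙∘ : ∀ α → 𝟙 ∘ α ≡ α
    ∘~ : ∀ s α → s ∘ (~ α) ≡ ~ (s ∘ α)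
    ∘∧ : ∀ s α β → s ∘ (α ∧ β) ≡ (s ∘ α) ∧ (s ∘ β)
    ·∘ : ∀ s t α → (s · t) ∘ α ≡ s ∘ (t ∘ α)
    []· : ∀ α s t u → (α [ s , t ]) · u ≡ α [ s · u , t · u ]
    ·[] : ∀ r α s t → r · (α [ s , t ]) ≡ (r ∘ α) [ r · s , r · t ]
    []∘ : ∀ α s t β → (α [ s , t ]) ∘ β ≡ α ⟦ s ∘ β , t ∘ β ⟧

record IsCongruence {ℓ : Level} (M : CAlgebra ℓ) (θ : Rel (CAlgebra.Carrier M) ℓ) : Set ℓ where
  open CAlgebra M
  field
    isEquivalence : IsEquivalence θ
    ∨-cong : ∀ {a b c d} → θ a b → θ c d → θ (a ∨ c) (b ∨ d)
    ∧-cong : ∀ {a b c d} → θ a b → θ c d → θ (a ∧ c) (b ∧ d)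
    ~-cong : ∀ {a b} → θ a b → θ (~ a) (~ b)

Proper : {ℓ : Level} {A : Set ℓ} → Rel A ℓ → Set ℓ
Proper {A = A} θ = ¬ (∀ (a b : A) → θ a b)

record IsMaximalCongruence {ℓ : Level} (M : CAlgebra ℓ) (θ : Rel (CAlgebra.Carrier M) ℓ) : Set (lsuc ℓ) where
  field
    isCongruence : IsCongruence M θ
    proper : Proper θ
    maximal : (ψ : Rel (CAlgebra.Carrier M) ℓ) → IsCongruence M ψ → Proper ψ →
              (∀ {a b} → θ a b → ψ a b) → (∀ {a b} → ψ a b → θ a b)

data 𝟛 : Set where
  T₃ F₃ U₃ : 𝟛

~₃_ : 𝟛 → 𝟛
~₃ T₃ = F₃
~₃ F₃ = T₃
~₃ U₃ = U₃

_∧₃_ : 𝟛 → 𝟛 → 𝟛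
T₃ ∧₃ x = x
F₃ ∧₃ x = F₃
U₃ ∧₃ x = U₃

_∨₃_ : 𝟛 → 𝟛 → 𝟛
T₃ ∨₃ x = T₃
F₃ ∨₃ x = x
U₃ ∨₃ x = U₃

module Construction {ℓ : Level} {M : CAlgebraTFU ℓ} (Sm : CMonoid M)
                    (θ : Rel (CAlgebraTFU.Carrier M) ℓ) where
  open CAlgebraTFU M
  open CMonoid Sm

  E : Rel S ℓ
  E s t = Σ Carrier (λ β → θ β T × (β [ s , t ] ≡ β [ t , t ]))

  -- representatives t of elements t̄ of S_θ = (S_⊥/E_θ) ∖ {⊥̄}
  InSθ : S → Set ℓ
  InSθ t = ¬ E t ⊥

  InA : Carrier → S → Set ℓ
  InA α t = θ (t ∘ α) T

  InB : Carrier → S → Set ℓ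
  InB α t = θ (t ∘ α) F

  ρ : ExcludedMiddle ℓ → Carrier → S → 𝟛
  ρ lem α t with lem {α ≡ T}
  ... | yes _ = T₃
  ... | no _ with lem {α ≡ F}
  ...   | yes _ = F₃
  ...   | no _ with lem {InA α t}
  ...     | yes _ = T₃
  ...     | no _ with lem {InB α t}
  ...       | yes _ = F₃
  ...       | no _ = U₃

-- Modulo a maximal congruence θ every element a of the ada is congruent to exactly one of T, F, U:
-- if the congruence "a ∧ x θ a ∧ y" is proper then by maximality it equals θ, which forces a θ T;
-- if it and its analogue for ¬a both collapse everything, then a θ U. For a representative t of a
-- class other than ⊥̄, the element t ∘ T is θ-congruent to T: otherwise the ada axioms force
-- (t ∘ T)↓ θ F, and then β = ¬((t ∘ T)↓) witnesses (t, ⊥) ∈ E_θ. Hence ρ_θ(α)(t̄) is just the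
-- class of t ∘ α, and ρ_θ is a homomorphism because x ↦ t ∘ x preserves ∧ and ¬.
module Submission where

open import Defs
open import Level using (Level)
open import Relation.Binary.PropositionalEquality
  using (_≡_; refl; sym; trans; cong; cong₂; subst; module ≡-Reasoning)
open import Relation.Nullary using (¬_; yes; no)
open import Relation.Nullary.Negation using (contradiction)
open import Relation.Binary using (Rel; IsEquivalence; Setoid)
open import Data.Product using (Σ; _×_; _,_)
open import Function.Bundles using (_⇔_; mk⇔)
open import Axiom.ExcludedMiddle using (ExcludedMiddle)

module CAlgebraTFUProperties {ℓ : Level} (M : CAlgebraTFU ℓ) where
  open CAlgebraTFU M
  open ≡-Reasoning

  ~-injective : ∀ {x y} → ~ x ≡ ~ y → x ≡ y
  ~-injective {x} {y} ~x≡~y = begin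
    x     ≡⟨ ~~ x ⟨
    ~ ~ x ≡⟨ cong ~_ ~x≡~y ⟩
    ~ ~ y ≡⟨ ~~ y ⟩
    y     ∎

  ∨≡~[~∧~] : ∀ x y → x ∨ y ≡ ~ (~ x ∧ ~ y)
  ∨≡~[~∧~] x y = begin
    x ∨ y         ≡⟨ cong₂ _∨_ (~~ x) (~~ y) ⟨
    ~ ~ x ∨ ~ ~ y ≡⟨ deMorgan (~ x) (~ y) ⟨
    ~ (~ x ∧ ~ y) ∎

  deMorgan-∨ : ∀ x y → ~ (x ∨ y) ≡ ~ x ∧ ~ y
  deMorgan-∨ x y = trans (cong ~_ (∨≡~[~∧~] x y)) (~~ _)

  ~T≡F : ~ T ≡ F
  ~T≡F = begin
    ~ T           ≡⟨ ∨-identityʳ (~ T) ⟨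
    ~ T ∨ F       ≡⟨ cong (~ T ∨_) (~~ F) ⟨
    ~ T ∨ ~ ~ F   ≡⟨ deMorgan T (~ F) ⟨
    ~ (T ∧ ~ F)   ≡⟨ cong ~_ (∧-identityˡ (~ F)) ⟩
    ~ ~ F         ≡⟨ ~~ F ⟩
    F             ∎

  ~F≡T : ~ F ≡ T
  ~F≡T = trans (cong ~_ (sym ~T≡F)) (~~ T)

  F∧x≡F : ∀ x → F ∧ x ≡ F
  F∧x≡F x = trans (sym (∨-identityˡ (F ∧ x))) (absorb F x)

  T∨x≡T : ∀ x → T ∨ x ≡ T
  T∨x≡T x = begin
    T ∨ x           ≡⟨ ∨≡~[~∧~] T x ⟩
    ~ (~ T ∧ ~ x)   ≡⟨ cong (λ z → ~ (z ∧ ~ x)) ~T≡F ⟩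
    ~ (F ∧ ~ x)     ≡⟨ cong ~_ (F∧x≡F (~ x)) ⟩
    ~ F             ≡⟨ ~F≡T ⟩
    T               ∎

  ∨-idem : ∀ x → x ∨ x ≡ x
  ∨-idem x = trans (cong (x ∨_) (sym (∧-identityʳ x))) (absorb x T)

  ∧-idem : ∀ x → x ∧ x ≡ x
  ∧-idem x = ~-injective (trans (deMorgan x x) (∨-idem (~ x)))

  x∨y≡x∨[~x∧y] : ∀ x y → x ∨ y ≡ x ∨ (~ x ∧ y)
  x∨y≡x∨[~x∧y] x y = begin
    x ∨ y                   ≡⟨ ∧-identityʳ _ ⟨
    (x ∨ y) ∧ T             ≡⟨ ∨∧-distribʳ x y T ⟩
    (x ∧ T) ∨ (~ x ∧ y ∧ T) ≡⟨ cong₂ (λ a b → a ∨ (~ x ∧ b)) (∧-identityʳ x) (∧-identityʳ y) ⟩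
    x ∨ (~ x ∧ y)           ∎

  x∧[~x∨y]≡x∧y : ∀ x y → x ∧ (~ x ∨ y) ≡ x ∧ y
  x∧[~x∨y]≡x∧y x y = ~-injective (begin
    ~ (x ∧ (~ x ∨ y))   ≡⟨ deMorgan x _ ⟩
    ~ x ∨ ~ (~ x ∨ y)   ≡⟨ cong (~ x ∨_) (deMorgan-∨ (~ x) y) ⟩
    ~ x ∨ (~ ~ x ∧ ~ y) ≡⟨ x∨y≡x∨[~x∧y] (~ x) (~ y) ⟨
    ~ x ∨ ~ y           ≡⟨ deMorgan x y ⟨
    ~ (x ∧ y)           ∎)

  x∧[y∨~x]≡x∧y : ∀ x y → x ∧ (y ∨ ~ x) ≡ x ∧ y
  x∧[y∨~x]≡x∧y x y = begin
    x ∧ (y ∨ ~ x)       ≡⟨ ∧-distribˡ x y (~ x) ⟩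
    (x ∧ y) ∨ (x ∧ ~ x) ≡⟨ cong ((x ∧ y) ∨_) x∧~x≡x∧F ⟩
    (x ∧ y) ∨ (x ∧ F)   ≡⟨ ∧-distribˡ x y F ⟨
    x ∧ (y ∨ F)         ≡⟨ cong (x ∧_) (∨-identityʳ y) ⟩
    x ∧ y               ∎
    where
    x∧~x≡x∧F : x ∧ ~ x ≡ x ∧ F
    x∧~x≡x∧F = trans (cong (x ∧_) (sym (∨-identityʳ (~ x)))) (x∧[~x∨y]≡x∧y x F)

  x∨[y∧~x]≡x∨y : ∀ x y → x ∨ (y ∧ ~ x) ≡ x ∨ y
  x∨[y∧~x]≡x∨y x y = ~-injective (begin
    ~ (x ∨ (y ∧ ~ x))     ≡⟨ deMorgan-∨ x _ ⟩
    ~ x ∧ ~ (y ∧ ~ x)     ≡⟨ cong (~ x ∧_) (deMorgan y (~ x)) ⟩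
    ~ x ∧ (~ y ∨ ~ ~ x)   ≡⟨ x∧[y∨~x]≡x∧y (~ x) (~ y) ⟩
    ~ x ∧ ~ y             ≡⟨ deMorgan-∨ x y ⟨
    ~ (x ∨ y)             ∎)

  x∧[y∧x]≡x∧y : ∀ x y → x ∧ (y ∧ x) ≡ x ∧ y
  x∧[y∧x]≡x∧y x y = begin
    x ∧ (y ∧ x)               ≡⟨ x∧[~x∨y]≡x∧y x _ ⟨
    x ∧ (~ x ∨ (y ∧ x))       ≡⟨ cong (λ z → x ∧ (~ x ∨ (y ∧ z))) (~~ x) ⟨
    x ∧ (~ x ∨ (y ∧ ~ ~ x))   ≡⟨ cong (x ∧_) (x∨[y∧~x]≡x∨y (~ x) y) ⟩
    x ∧ (~ x ∨ y)             ≡⟨ x∧[~x∨y]≡x∧y x y ⟩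
    x ∧ y                     ∎

  [x∧y]∧z≡[x∧y]∧[x∧z] : ∀ x y z → (x ∧ y) ∧ z ≡ (x ∧ y) ∧ (x ∧ z)
  [x∧y]∧z≡[x∧y]∧[x∧z] x y z = begin
    (x ∧ y) ∧ z         ≡⟨ cong (_∧ z) (x∧[y∧x]≡x∧y x y) ⟨
    (x ∧ (y ∧ x)) ∧ z   ≡⟨ cong (_∧ z) (∧-assoc x y x) ⟨
    ((x ∧ y) ∧ x) ∧ z   ≡⟨ ∧-assoc (x ∧ y) x z ⟩
    (x ∧ y) ∧ (x ∧ z)   ∎

  x∧~[x∧y]≡x∧~y : ∀ x y → x ∧ ~ (x ∧ y) ≡ x ∧ ~ y
  x∧~[x∧y]≡x∧~y x y = trans (cong (x ∧_) (deMorgan x y)) (x∧[~x∨y]≡x∧y x (~ y))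

  U∧F≡U : U ∧ F ≡ U
  U∧F≡U = ~-injective (begin
    ~ (U ∧ F) ≡⟨ deMorgan U F ⟩
    ~ U ∨ ~ F ≡⟨ cong₂ _∨_ ~U ~F≡T ⟩
    U ∨ T     ≡⟨ U∨T≡U ⟩
    U         ≡⟨ ~U ⟨
    ~ U       ∎)
    where
    U∨T≡U : U ∨ T ≡ U
    U∨T≡U = begin
      U ∨ T                   ≡⟨ ∧-identityʳ _ ⟨
      (U ∨ T) ∧ T             ≡⟨ ∨∧-distribʳ U T T ⟩
      (U ∧ T) ∨ (~ U ∧ T ∧ T) ≡⟨ cong₂ (λ a b → a ∨ (b ∧ T ∧ T)) (∧-identityʳ U) ~U ⟩
      U ∨ (U ∧ T ∧ T)         ≡⟨ cong (λ z → U ∨ (U ∧ z)) (∧-identityʳ T) ⟩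
      U ∨ (U ∧ T)             ≡⟨ absorb U T ⟩
      U                       ∎

  U∧x≡U : ∀ x → U ∧ x ≡ U
  U∧x≡U x = begin
    U ∧ x       ≡⟨ cong (_∧ x) U∧F≡U ⟨
    (U ∧ F) ∧ x ≡⟨ ∧-assoc U F x ⟩
    U ∧ (F ∧ x) ≡⟨ cong (U ∧_) (F∧x≡F x) ⟩
    U ∧ F       ≡⟨ U∧F≡U ⟩
    U           ∎

  U∨x≡U : ∀ x → U ∨ x ≡ U
  U∨x≡U x = begin
    U ∨ x         ≡⟨ ∨≡~[~∧~] U x ⟩
    ~ (~ U ∧ ~ x) ≡⟨ cong (λ z → ~ (z ∧ ~ x)) ~U ⟩
    ~ (U ∧ ~ x)   ≡⟨ cong ~_ (U∧x≡U (~ x)) ⟩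
    ~ U           ≡⟨ ~U ⟩
    U             ∎

  [x∧U]∨U≡U : ∀ x → (x ∧ U) ∨ U ≡ U
  [x∧U]∨U≡U x = begin
    (x ∧ U) ∨ U       ≡⟨ cong ((x ∧ U) ∨_) (U∧x≡U x) ⟨
    (x ∧ U) ∨ (U ∧ x) ≡⟨ ∨∧-comm x U ⟩
    (U ∧ x) ∨ (x ∧ U) ≡⟨ cong (_∨ (x ∧ U)) (U∧x≡U x) ⟩
    U ∨ (x ∧ U)       ≡⟨ U∨x≡U _ ⟩
    U                 ∎

  embed : 𝟛 → Carrier
  embed T₃ = T
  embed F₃ = F
  embed U₃ = U

  embed-~ : ∀ c → ~ embed c ≡ embed (~₃ c)
  embed-~ T₃ = ~T≡F
  embed-~ F₃ = ~F≡T
  embed-~ U₃ = ~U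

  embed-∧ : ∀ c d → embed c ∧ embed d ≡ embed (c ∧₃ d)
  embed-∧ T₃ d = ∧-identityˡ _
  embed-∧ F₃ d = F∧x≡F _
  embed-∧ U₃ d = U∧x≡U _

  embed-∨ : ∀ c d → embed c ∨ embed d ≡ embed (c ∨₃ d)
  embed-∨ T₃ d = T∨x≡T _
  embed-∨ F₃ d = ∨-identityˡ _
  embed-∨ U₃ d = U∨x≡U _

module AdaProperties {ℓ : Level} (A : Ada ℓ) where
  open Ada A

  x≡x∧x↓ : ∀ x → x ≡ x ∧ (x ↓)
  x≡x∧x↓ x = begin
    x             ≡⟨ ∧-identityʳ x ⟨
    x ∧ T         ≡⟨ cong (x ∧_) T↓ ⟨
    x ∧ (T ↓)     ≡⟨ ∧↓ x T ⟩
    x ∧ ((x ∧ T) ↓) ≡⟨ cong (λ z → x ∧ (z ↓)) (∧-identityʳ x) ⟩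
    x ∧ (x ↓)     ∎
    where open ≡-Reasoning

module CongruenceProperties {ℓ : Level} (M : CAlgebraTFU ℓ)
                            {θ : Rel (CAlgebraTFU.Carrier M) ℓ}
                            (isCongruence : IsCongruence (CAlgebraTFU.calg M) θ) where
  open CAlgebraTFU M
  open CAlgebraTFUProperties M
  open IsCongruence isCongruence public
  open IsEquivalence isEquivalence public
    renaming (refl to θ-refl; sym to θ-sym; trans to θ-trans)

  θ-setoid : Setoid ℓ ℓ
  θ-setoid = record { isEquivalence = isEquivalence }

  ≡⇒θ : ∀ {x y} → x ≡ y → θ x y
  ≡⇒θ refl = θ-refl

  θ-below : Carrier → Rel Carrier ℓ
  θ-below a x y = θ (a ∧ x) (a ∧ y)

  θ⇒θ-below : ∀ a {x y} → θ x y → θ-below a x y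
  θ⇒θ-below a = ∧-cong θ-refl

  θ-below-isCongruence : ∀ a → IsCongruence calg (θ-below a)
  θ-below-isCongruence a = record
    { isEquivalence = record { refl = θ-refl ; sym = θ-sym ; trans = θ-trans }
    ; ∨-cong = λ {x} {y} {z} {w} x≈y z≈w → begin
        a ∧ (x ∨ z)         ≡⟨ ∧-distribˡ a x z ⟩
        (a ∧ x) ∨ (a ∧ z)   ≈⟨ ∨-cong x≈y z≈w ⟩
        (a ∧ y) ∨ (a ∧ w)   ≡⟨ ∧-distribˡ a y w ⟨
        a ∧ (y ∨ w)         ∎
    ; ∧-cong = λ {x} {y} {z} {w} x≈y z≈w → begin
        a ∧ (x ∧ z)         ≡⟨ ∧-assoc a x z ⟨
        (a ∧ x) ∧ z         ≈⟨ ∧-cong x≈y θ-refl ⟩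
        (a ∧ y) ∧ z         ≡⟨ [x∧y]∧z≡[x∧y]∧[x∧z] a y z ⟩
        (a ∧ y) ∧ (a ∧ z)   ≈⟨ ∧-cong θ-refl z≈w ⟩
        (a ∧ y) ∧ (a ∧ w)   ≡⟨ [x∧y]∧z≡[x∧y]∧[x∧z] a y w ⟨
        (a ∧ y) ∧ w         ≡⟨ ∧-assoc a y w ⟩
        a ∧ (y ∧ w)         ∎
    ; ~-cong = λ {x} {y} x≈y → begin
        a ∧ ~ x             ≡⟨ x∧~[x∧y]≡x∧~y a x ⟨
        a ∧ ~ (a ∧ x)       ≈⟨ ∧-cong θ-refl (~-cong x≈y) ⟩
        a ∧ ~ (a ∧ y)       ≡⟨ x∧~[x∧y]≡x∧~y a y ⟩
        a ∧ ~ y             ∎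
    }
    where open import Relation.Binary.Reasoning.Setoid θ-setoid

module MaximalCongruenceProperties {ℓ : Level} (M : CAlgebraTFU ℓ)
                                   {θ : Rel (CAlgebraTFU.Carrier M) ℓ}
                                   (isMaximal : IsMaximalCongruence (CAlgebraTFU.calg M) θ) where
  open CAlgebraTFU M
  open CAlgebraTFUProperties M
  open IsMaximalCongruence isMaximal
  open CongruenceProperties M isCongruence public
  open import Relation.Binary.Reasoning.Setoid θ-setoid

  ¬θTF : ¬ θ T F
  ¬θTF θTF = proper (λ a b → θ-trans (θ-F a) (θ-sym (θ-F b)))
    where
    θ-F : ∀ a → θ a F
    θ-F a = begin
      a     ≡⟨ ∧-identityˡ a ⟨
      T ∧ a ≈⟨ ∧-cong θTF θ-refl ⟩
      F ∧ a ≡⟨ F∧x≡F a ⟩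
      F     ∎

  ¬θTU : ¬ θ T U
  ¬θTU θTU = ¬θTF (begin
    T   ≈⟨ θTU ⟩
    U   ≡⟨ ~U ⟨
    ~ U ≈⟨ ~-cong θTU ⟨
    ~ T ≡⟨ ~T≡F ⟩
    F   ∎)

  ¬θFU : ¬ θ F U
  ¬θFU θFU = ¬θTU (begin
    T   ≡⟨ ~F≡T ⟨
    ~ F ≈⟨ ~-cong θFU ⟩
    ~ U ≡⟨ ~U ⟩
    U   ∎)

  embed-injective : ∀ c d → θ (embed c) (embed d) → c ≡ d
  embed-injective T₃ T₃ _ = refl
  embed-injective T₃ F₃ θTF = contradiction θTF ¬θTF
  embed-injective T₃ U₃ θTU = contradiction θTU ¬θTU
  embed-injective F₃ T₃ θFT = contradiction (θ-sym θFT) ¬θTF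
  embed-injective F₃ F₃ _ = refl
  embed-injective F₃ U₃ θFU = contradiction θFU ¬θFU
  embed-injective U₃ T₃ θUT = contradiction (θ-sym θUT) ¬θTU
  embed-injective U₃ F₃ θUF = contradiction (θ-sym θUF) ¬θFU
  embed-injective U₃ U₃ _ = refl

  Proper-θ-below⇒θT : ∀ a → Proper (θ-below a) → θ a T
  Proper-θ-below⇒θT a proper-a =
    maximal (θ-below a) (θ-below-isCongruence a) proper-a (θ⇒θ-below a)
      (≡⇒θ (trans (∧-idem a) (sym (∧-identityʳ a))))

  Total : Rel Carrier ℓ → Set ℓ
  Total ψ = ∀ x y → ψ x y

  Total-θ-below⇒θ[a∧x]a : ∀ {a} → Total (θ-below a) → ∀ x → θ (a ∧ x) a
  Total-θ-below⇒θ[a∧x]a {a} total x = begin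
    a ∧ x       ≈⟨ ∧-cong a≈a∧F θ-refl ⟩
    (a ∧ F) ∧ x ≡⟨ ∧-assoc a F x ⟩
    a ∧ (F ∧ x) ≡⟨ cong (a ∧_) (F∧x≡F x) ⟩
    a ∧ F       ≈⟨ a≈a∧F ⟨
    a           ∎
    where
    a≈a∧F : θ a (a ∧ F)
    a≈a∧F = θ-trans (≡⇒θ (sym (∧-identityʳ a))) (total T F)

  Total-θ-below-±⇒θU : ∀ {a} → Total (θ-below a) → Total (θ-below (~ a)) → θ a U
  Total-θ-below-±⇒θU {a} total total~ = begin
    a               ≡⟨ ~~ a ⟨
    ~ ~ a           ≈⟨ ~-cong (Total-θ-below⇒θ[a∧x]a total~ (~ U)) ⟨
    ~ (~ a ∧ ~ U)   ≡⟨ ∨≡~[~∧~] a U ⟨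
    a ∨ U           ≈⟨ ∨-cong (Total-θ-below⇒θ[a∧x]a total U) θ-refl ⟨
    (a ∧ U) ∨ U     ≡⟨ [x∧U]∨U≡U a ⟩
    U               ∎

  trichotomy : ExcludedMiddle ℓ → ∀ a → Σ 𝟛 λ c → θ a (embed c)
  trichotomy lem a with lem {Total (θ-below a)} | lem {Total (θ-below (~ a))}
  ... | no ¬total | _ = T₃ , Proper-θ-below⇒θT a ¬total
  ... | yes _ | no ¬total~ = F₃ , (begin
    a     ≡⟨ ~~ a ⟨
    ~ ~ a ≈⟨ ~-cong (Proper-θ-below⇒θT (~ a) ¬total~) ⟩
    ~ T   ≡⟨ ~T≡F ⟩
    F     ∎)
  ... | yes total | yes total~ = U₃ , Total-θ-below-±⇒θU total total~

module CMonoidProperties {ℓ : Level} (A : Ada ℓ) (Sm : CMonoid (Ada.tfu A)) where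
  open Ada A
  open CMonoid Sm
  open CAlgebraTFUProperties tfu
  open AdaProperties A
  open ≡-Reasoning

  T[] : ∀ s t → T [ s , t ] ≡ s
  T[] s t = begin
    T [ s , t ]     ≡⟨ cong (_[ s , t ]) ~F≡T ⟨
    (~ F) [ s , t ] ≡⟨ ~[] F s t ⟩
    F [ t , s ]     ≡⟨ F[] t s ⟩
    s               ∎

  [⊥,⊥]≡⊥ : ∀ α → α [ ⊥ , ⊥ ] ≡ ⊥
  [⊥,⊥]≡⊥ α = begin
    α [ ⊥ , ⊥ ]         ≡⟨ cong₂ (α [_,_]) (·-zeroʳ ⊥) (·-zeroʳ ⊥) ⟨
    α [ ⊥ · ⊥ , ⊥ · ⊥ ] ≡⟨ []· α ⊥ ⊥ ⊥ ⟨
    (α [ ⊥ , ⊥ ]) · ⊥   ≡⟨ ·-zeroʳ _ ⟩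
    ⊥                   ∎

  [t∘T][t,⊥]≡t : ∀ t → (t ∘ T) [ t , ⊥ ] ≡ t
  [t∘T][t,⊥]≡t t = begin
    (t ∘ T) [ t , ⊥ ]         ≡⟨ cong₂ ((t ∘ T) [_,_]) (·-identityʳ t) (·-zeroʳ t) ⟨
    (t ∘ T) [ t · 𝟙 , t · ⊥ ] ≡⟨ ·[] t T 𝟙 ⊥ ⟨
    t · (T [ 𝟙 , ⊥ ])         ≡⟨ cong (t ·_) (T[] 𝟙 ⊥) ⟩
    t · 𝟙                     ≡⟨ ·-identityʳ t ⟩
    t                         ∎

  ↓[⊥,s]≡⊥ : ∀ γ s → γ [ s , ⊥ ] ≡ s → (γ ↓) [ ⊥ , s ] ≡ ⊥
  ↓[⊥,s]≡⊥ γ s γ[s,⊥]≡s = begin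
    δ [ ⊥ , s ]                         ≡⟨ cong₂ (δ [_,_]) ([⊥,⊥]≡⊥ γ) γ[s,⊥]≡s ⟨
    δ [ γ [ ⊥ , ⊥ ] , γ [ s , ⊥ ] ]     ≡⟨ [][] δ γ ⊥ ⊥ s ⊥ ⟩
    γ [ δ [ ⊥ , s ] , δ [ ⊥ , ⊥ ] ]     ≡⟨ cong (γ [ δ [ ⊥ , s ] ,_]) ([⊥,⊥]≡⊥ δ) ⟩
    γ [ δ [ ⊥ , s ] , ⊥ ]               ≡⟨ cong (_[ δ [ ⊥ , s ] , ⊥ ]) (x≡x∧x↓ γ) ⟩
    (γ ∧ δ) [ δ [ ⊥ , s ] , ⊥ ]         ≡⟨ ∧[] γ δ _ ⊥ ⟩
    γ [ δ [ δ [ ⊥ , s ] , ⊥ ] , ⊥ ]     ≡⟨ cong (γ [_, ⊥ ]) ([[]]ˡ δ ⊥ s ⊥) ⟩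
    γ [ δ [ ⊥ , ⊥ ] , ⊥ ]               ≡⟨ cong (γ [_, ⊥ ]) ([⊥,⊥]≡⊥ δ) ⟩
    γ [ ⊥ , ⊥ ]                         ≡⟨ [⊥,⊥]≡⊥ γ ⟩
    ⊥                                   ∎
    where
    δ = γ ↓

  []-sym : ∀ β {s t} → β [ s , t ] ≡ β [ t , t ] → β [ t , s ] ≡ β [ s , s ]
  []-sym β {s} {t} β[s,t]≡β[t,t] = begin
    β [ t , s ]             ≡⟨ [[]]ˡ β t t s ⟨
    β [ β [ t , t ] , s ]   ≡⟨ cong (β [_, s ]) β[s,t]≡β[t,t] ⟨
    β [ β [ s , t ] , s ]   ≡⟨ [[]]ˡ β s t s ⟩
    β [ s , s ]             ∎

  []-trans : ∀ β γ {s t u} → β [ s , t ] ≡ β [ t , t ] → γ [ t , u ] ≡ γ [ u , u ] →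
             (β ∧ γ) [ s , u ] ≡ (β ∧ γ) [ u , u ]
  []-trans β γ {s} {t} {u} β[s,t]≡β[t,t] γ[t,u]≡γ[u,u] = begin
    (β ∧ γ) [ s , u ]                   ≡⟨ [[]]ˡ (β ∧ γ) s t u ⟨
    (β ∧ γ) [ (β ∧ γ) [ s , t ] , u ]   ≡⟨ cong ((β ∧ γ) [_, u ]) ([]-cong β γ s t β[s,t]≡β[t,t]) ⟩
    (β ∧ γ) [ (β ∧ γ) [ t , t ] , u ]   ≡⟨ [[]]ˡ (β ∧ γ) t t u ⟩
    (β ∧ γ) [ t , u ]                   ≡⟨ ∧[] β γ t u ⟩
    β [ γ [ t , u ] , u ]               ≡⟨ cong (β [_, u ]) γ[t,u]≡γ[u,u] ⟩
    β [ γ [ u , u ] , u ]               ≡⟨ ∧[] β γ u u ⟨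
    (β ∧ γ) [ u , u ]                   ∎

  ~[t∘T]↓[t,⊥]≡~[t∘T]↓[⊥,⊥] : ∀ t → (~ ((t ∘ T) ↓)) [ t , ⊥ ] ≡ (~ ((t ∘ T) ↓)) [ ⊥ , ⊥ ]
  ~[t∘T]↓[t,⊥]≡~[t∘T]↓[⊥,⊥] t = begin
    (~ ((t ∘ T) ↓)) [ t , ⊥ ]   ≡⟨ ~[] _ t ⊥ ⟩
    ((t ∘ T) ↓) [ ⊥ , t ]       ≡⟨ ↓[⊥,s]≡⊥ (t ∘ T) t ([t∘T][t,⊥]≡t t) ⟩
    ⊥                           ≡⟨ [⊥,⊥]≡⊥ _ ⟨
    (~ ((t ∘ T) ↓)) [ ⊥ , ⊥ ]   ∎

  ∘-distrib-∨ : ∀ t α β → t ∘ (α ∨ β) ≡ (t ∘ α) ∨ (t ∘ β)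
  ∘-distrib-∨ t α β = begin
    t ∘ (α ∨ β)                 ≡⟨ cong (t ∘_) (∨≡~[~∧~] α β) ⟩
    t ∘ (~ (~ α ∧ ~ β))         ≡⟨ ∘~ t _ ⟩
    ~ (t ∘ (~ α ∧ ~ β))         ≡⟨ cong ~_ (∘∧ t (~ α) (~ β)) ⟩
    ~ ((t ∘ (~ α)) ∧ (t ∘ (~ β))) ≡⟨ cong₂ (λ a b → ~ (a ∧ b)) (∘~ t α) (∘~ t β) ⟩
    ~ (~ (t ∘ α) ∧ ~ (t ∘ β))   ≡⟨ ∨≡~[~∧~] _ _ ⟨
    (t ∘ α) ∨ (t ∘ β)           ∎

module ConstructionProperties {ℓ : Level} (lem : ExcludedMiddle ℓ) (A : Ada ℓ)
                              (Sm : CMonoid (Ada.tfu A)) {θ : Rel (Ada.Carrier A) ℓ}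
                              (isMaximal : IsMaximalCongruence (Ada.calg A) θ) where
  open Ada A
  open CMonoid Sm
  open Construction Sm θ
  open CAlgebraTFUProperties tfu
  open MaximalCongruenceProperties tfu isMaximal
  open CMonoidProperties A Sm
  open import Relation.Binary.Reasoning.Setoid θ-setoid

  E-isEquivalence : IsEquivalence E
  E-isEquivalence = record
    { refl = T , θ-refl , refl
    ; sym = λ { (β , θβT , eq) → β , θβT , []-sym β eq }
    ; trans = λ { (β , θβT , eq) (γ , θγT , eq′) →
        β ∧ γ , θ-trans (∧-cong θβT θγT) (≡⇒θ (∧-identityˡ T)) , []-trans β γ eq eq′ }
    }

  θT⇒[s,t]∘α≈s∘α : ∀ {β} s t α → θ β T → θ ((β [ s , t ]) ∘ α) (s ∘ α)
  θT⇒[s,t]∘α≈s∘α {β} s t α θβT = begin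
    (β [ s , t ]) ∘ α                   ≡⟨ []∘ β s t α ⟩
    (β ∧ (s ∘ α)) ∨ (~ β ∧ (t ∘ α))     ≈⟨ ∨-cong (∧-cong θβT θ-refl) (∧-cong (~-cong θβT) θ-refl) ⟩
    (T ∧ (s ∘ α)) ∨ (~ T ∧ (t ∘ α))     ≡⟨ cong₂ _∨_ (∧-identityˡ _) (trans (cong (_∧ (t ∘ α)) ~T≡F) (F∧x≡F _)) ⟩
    (s ∘ α) ∨ F                         ≡⟨ ∨-identityʳ _ ⟩
    s ∘ α                               ∎

  E⇒∘≈∘ : ∀ {s t} → E s t → ∀ α → θ (s ∘ α) (t ∘ α)
  E⇒∘≈∘ {s} {t} (β , θβT , eq) α = begin
    s ∘ α               ≈⟨ θT⇒[s,t]∘α≈s∘α s t α θβT ⟨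
    (β [ s , t ]) ∘ α   ≡⟨ cong (_∘ α) eq ⟩
    (β [ t , t ]) ∘ α   ≈⟨ θT⇒[s,t]∘α≈s∘α t t α θβT ⟩
    t ∘ α               ∎

  E⊥⇒∘≈U : ∀ {t} → E t ⊥ → ∀ α → θ (t ∘ α) U
  E⊥⇒∘≈U t⊥ α = θ-trans (E⇒∘≈∘ t⊥ α) (≡⇒θ (⊥∘ α))

  E⊥⇒¬InA×¬InB : ∀ α t → E t ⊥ → ¬ InA α t × ¬ InB α t
  E⊥⇒¬InA×¬InB α t t⊥ =
    (λ θT → ¬θTU (θ-trans (θ-sym θT) (E⊥⇒∘≈U t⊥ α))) ,
    (λ θF → ¬θFU (θ-trans (θ-sym θF) (E⊥⇒∘≈U t⊥ α)))

  E⇒InA⇔InA×InB⇔InB : ∀ α s t → E s t → (InA α s ⇔ InA α t) × (InB α s ⇔ InB α t)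
  E⇒InA⇔InA×InB⇔InB α s t st =
    mk⇔ (θ-trans (θ-sym s∘α≈t∘α)) (θ-trans s∘α≈t∘α) ,
    mk⇔ (θ-trans (θ-sym s∘α≈t∘α)) (θ-trans s∘α≈t∘α)
    where
    s∘α≈t∘α : θ (s ∘ α) (t ∘ α)
    s∘α≈t∘α = E⇒∘≈∘ st α

  ¬InA×InB : ∀ α t → ¬ (InA α t × InB α t)
  ¬InA×InB α t (θT , θF) = ¬θTF (θ-trans (θ-sym θT) θF)

  InSθ⇒∘T≈T : ∀ {t} → InSθ t → θ (t ∘ T) T
  InSθ⇒∘T≈T {t} t∈Sθ = byClassOf↓ (trichotomy lem δ)
    where
    δ = (t ∘ T) ↓
    byClassOf↓ : Σ 𝟛 (λ c → θ δ (embed c)) → θ (t ∘ T) T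
    byClassOf↓ (T₃ , θδT) = begin
      t ∘ T         ≡⟨ ↓∨ (t ∘ T) ⟩
      δ ∨ (t ∘ T)   ≈⟨ ∨-cong θδT θ-refl ⟩
      T ∨ (t ∘ T)   ≡⟨ T∨x≡T _ ⟩
      T             ∎
    byClassOf↓ (F₃ , θδF) =
      contradiction (~ δ , θ-trans (~-cong θδF) (≡⇒θ ~F≡T) , ~[t∘T]↓[t,⊥]≡~[t∘T]↓[⊥,⊥] t) t∈Sθ
    byClassOf↓ (U₃ , θδU) = contradiction (begin
      T             ≡⟨ ↓∨~↓ (t ∘ T) ⟨
      δ ∨ ~ δ       ≈⟨ ∨-cong θδU (~-cong θδU) ⟩
      U ∨ ~ U       ≡⟨ U∨x≡U _ ⟩
      U             ∎) ¬θTU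

  InSθ⇒∘F≈F : ∀ {t} → InSθ t → θ (t ∘ F) F
  InSθ⇒∘F≈F {t} t∈Sθ = begin
    t ∘ F       ≡⟨ cong (t ∘_) ~T≡F ⟨
    t ∘ (~ T)   ≡⟨ ∘~ t T ⟩
    ~ (t ∘ T)   ≈⟨ ~-cong (InSθ⇒∘T≈T t∈Sθ) ⟩
    ~ T         ≡⟨ ~T≡F ⟩
    F           ∎

  θ⇒ρ≡ : ∀ {t} → InSθ t → ∀ α c → θ (t ∘ α) (embed c) → ρ lem α t ≡ c
  θ⇒ρ≡ {t} t∈Sθ α c t∘α≈c with lem {α ≡ T}
  ... | yes refl = embed-injective T₃ c (θ-trans (θ-sym (InSθ⇒∘T≈T t∈Sθ)) t∘α≈c)
  ... | no _ with lem {α ≡ F}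
  ...   | yes refl = embed-injective F₃ c (θ-trans (θ-sym (InSθ⇒∘F≈F t∈Sθ)) t∘α≈c)
  ...   | no _ with lem {InA α t}
  ...     | yes t∈A = embed-injective T₃ c (θ-trans (θ-sym t∈A) t∘α≈c)
  ...     | no t∉A with lem {InB α t}
  ...       | yes t∈B = embed-injective F₃ c (θ-trans (θ-sym t∈B) t∘α≈c)
  ...       | no t∉B = neither c t∘α≈c
    where
    neither : ∀ c → θ (t ∘ α) (embed c) → U₃ ≡ c
    neither T₃ t∈A = contradiction t∈A t∉A
    neither F₃ t∈B = contradiction t∈B t∉B
    neither U₃ _ = refl

  ∘≈ρ : ∀ {t} → InSθ t → ∀ α → θ (t ∘ α) (embed (ρ lem α t))
  ∘≈ρ {t} t∈Sθ α with trichotomy lem (t ∘ α)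
  ... | c , t∘α≈c = subst (λ d → θ (t ∘ α) (embed d)) (sym (θ⇒ρ≡ t∈Sθ α c t∘α≈c)) t∘α≈c

  module _ {t : S} (t∈Sθ : InSθ t) where

    ρ-T : ρ lem T t ≡ T₃
    ρ-T = θ⇒ρ≡ t∈Sθ T T₃ (InSθ⇒∘T≈T t∈Sθ)

    ρ-F : ρ lem F t ≡ F₃
    ρ-F = θ⇒ρ≡ t∈Sθ F F₃ (InSθ⇒∘F≈F t∈Sθ)

    ρ-U : ρ lem U t ≡ U₃
    ρ-U = θ⇒ρ≡ t∈Sθ U U₃ (≡⇒θ (∘U t))

    ρ-~ : ∀ α → ρ lem (~ α) t ≡ ~₃ ρ lem α t
    ρ-~ α = θ⇒ρ≡ t∈Sθ (~ α) _ (begin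
      t ∘ (~ α)               ≡⟨ ∘~ t α ⟩
      ~ (t ∘ α)               ≈⟨ ~-cong (∘≈ρ t∈Sθ α) ⟩
      ~ embed (ρ lem α t)     ≡⟨ embed-~ (ρ lem α t) ⟩
      embed (~₃ ρ lem α t)    ∎)

    ρ-∧ : ∀ α β → ρ lem (α ∧ β) t ≡ ρ lem α t ∧₃ ρ lem β t
    ρ-∧ α β = θ⇒ρ≡ t∈Sθ (α ∧ β) _ (begin
      t ∘ (α ∧ β)                             ≡⟨ ∘∧ t α β ⟩
      (t ∘ α) ∧ (t ∘ β)                       ≈⟨ ∧-cong (∘≈ρ t∈Sθ α) (∘≈ρ t∈Sθ β) ⟩
      embed (ρ lem α t) ∧ embed (ρ lem β t)   ≡⟨ embed-∧ (ρ lem α t) (ρ lem β t) ⟩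
      embed (ρ lem α t ∧₃ ρ lem β t)          ∎)

    ρ-∨ : ∀ α β → ρ lem (α ∨ β) t ≡ ρ lem α t ∨₃ ρ lem β t
    ρ-∨ α β = θ⇒ρ≡ t∈Sθ (α ∨ β) _ (begin
      t ∘ (α ∨ β)                             ≡⟨ ∘-distrib-∨ t α β ⟩
      (t ∘ α) ∨ (t ∘ β)                       ≈⟨ ∨-cong (∘≈ρ t∈Sθ α) (∘≈ρ t∈Sθ β) ⟩
      embed (ρ lem α t) ∨ embed (ρ lem β t)   ≡⟨ embed-∨ (ρ lem α t) (ρ lem β t) ⟩
      embed (ρ lem α t ∨₃ ρ lem β t)          ∎)

proposition3p5 : {ℓ : Level} (lem : ExcludedMiddle ℓ) (A : Ada ℓ) (Sm : CMonoid (Ada.tfu A))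
    (θ : Rel (Ada.Carrier A) ℓ) → IsMaximalCongruence (Ada.calg A) θ →
    let open Ada A
        open CMonoid Sm
        open Construction Sm θ
    in
    IsEquivalence E
    × (∀ α t → E t ⊥ → ¬ InA α t × ¬ InB α t)
    × (∀ α s t → E s t → (InA α s ⇔ InA α t) × (InB α s ⇔ InB α t))
    × (∀ α t → ¬ (InA α t × InB α t))
    × (∀ t → InSθ t →
         (ρ lem T t ≡ T₃) × (ρ lem F t ≡ F₃) × (ρ lem U t ≡ U₃)
         × (∀ α → ρ lem (~ α) t ≡ ~₃ ρ lem α t)
         × (∀ α β → ρ lem (α ∧ β) t ≡ ρ lem α t ∧₃ ρ lem β t)
         × (∀ α β → ρ lem (α ∨ β) t ≡ ρ lem α t ∨₃ ρ lem β t))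
proposition3p5 lem A Sm θ isMaximal =
  E-isEquivalence , E⊥⇒¬InA×¬InB , E⇒InA⇔InA×InB⇔InB , ¬InA×InB ,
  λ _ t∈Sθ → ρ-T t∈Sθ , ρ-F t∈Sθ , ρ-U t∈Sθ , ρ-~ t∈Sθ , ρ-∧ t∈Sθ , ρ-∨ t∈Sθ
  where open ConstructionProperties lem A Sm isMaximal
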